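{- Let $k\ge1$ and $n\ge1$, and let $\tau_n$ be a uniformly random $(k+1)$-ary increasing tree of order $n$. Then the distribution of the random vector $(L_{n,1},\dots,L_{n,k+1})$ of $\tau_n$ is exchangeable, i.e. invariant under any permutation of its $k+1$ coordinates.
   Context: A $(k+1)$-ary increasing tree of order $n$ is a rooted tree with vertex set $\{1,\dots,n\}$, root $1$, labels increasing along every path away from the root, in which every vertex has $k+1$ positions numbered $1,\dots,k+1$ from left to right, each position empty or occupied by exactly one child, and each non-root vertex occupies exactly one position of its parent. $L_{n,j}$ is the number of pairs (vertex $v$, position $j$ of $v$) such that position $j$ of $v$ is empty. -}

module Defs where

open import Data.Nat using (ℕ; zero; suc)
open import Data.Nat.Properties using () renaming (_≟_ to _≟ℕ_)
open import Data.Fin using (Fin)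
open import Data.Fin.Properties using () renaming (_≟_ to _≟F_)
open import Data.List using (List; []; _∷_; [_]; _++_; map; concatMap; filter; length; upTo; allFin)
open import Data.List.Membership.DecPropositional using ()
open import Data.List.Relation.Unary.Unique.DecPropositional using (unique?)
open import Data.Product using (_×_; _,_)
open import Data.Product.Properties using (≡-dec)
open import Data.Vec using (Vec; tabulate)
open import Data.Vec.Properties using () renaming (≡-dec to ≡-decVec)
open import Relation.Binary.Definitions using (DecidableEquality)
open import Relation.Nullary using (¬?)
import Data.List.Membership.DecPropositional as DecMem

-- A (k+1)-ary increasing tree of order n ≥ 1 (vertices 1..n, root 1) is
-- encoded by the list of (parent , position) pairs of the non-root
-- vertices 2,3,…,n in this order: the i-th entry (0-based) describes
-- vertex i+2, its parent p with 1 ≤ p < i+2, and the position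
-- j ∈ Fin (k+1) (position j+1 in 1-based numbering) it occupies at p.
Slot : ℕ → Set
Slot k = ℕ × Fin (suc k)

Code : ℕ → Set
Code k = List (Slot k)

_≟S_ : {k : ℕ} → DecidableEquality (Slot k)
_≟S_ = ≡-dec _≟ℕ_ _≟F_

codes : (k n : ℕ) → List (Code k)
codes k zero = []
codes k (suc zero) = [ [] ]
codes k (suc (suc m)) =
  concatMap (λ t → concatMap (λ p → map (λ j → t ++ [ (p , j) ]) (allFin (suc k)))
                             (map suc (upTo (suc m))))
            (codes k (suc m))

-- Increasing trees: each position of each vertex holds at most one child,
-- i.e. the (parent , position) pairs are pairwise distinct.
trees : (k n : ℕ) → List (Code k)
trees k n = filter (unique? _≟S_) (codes k n)

L : (k n : ℕ) → Code k → Fin (suc k) → ℕ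
L k n t j = length (filter (λ v → ¬? (DecMem._∈?_ _≟S_ (v , j) t)) (map suc (upTo n)))

Lvec : (k n : ℕ) → Code k → Vec ℕ (suc k)
Lvec k n t = tabulate (L k n t)

-- Number of increasing trees of order n with (L_{n,1},…,L_{n,k+1}) = c.
-- Under the uniform distribution, P(L-vector = c) = count k n c / |trees k n|.
count : (k n : ℕ) → Vec ℕ (suc k) → ℕ
count k n c = length (filter (λ t → ≡-decVec _≟ℕ_ (Lvec k n t) c) (trees k n))

module Submission where

-- Idea: a permutation σ of the positions {1,…,k+1} acts on trees by moving
-- every child from position j of its parent to position σ⁻¹(j).  This
-- relabelling is a bijection of the set of increasing trees of order n, and
-- it permutes the empty-position counts: position i of a vertex is empty in
-- the relabelled tree iff position σ(i) is empty in the original, so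
-- (L_{n,i})ᵢ becomes (L_{n,σ(i)})ᵢ.  Hence the trees with count vector c
-- are mapped bijectively onto the trees with count vector c∘σ.

open import Defs
open import Data.Nat using (ℕ; zero; suc; _≤_)
open import Data.Nat.Properties using () renaming (_≟_ to _≟ℕ_)
open import Data.Fin using (Fin)
open import Data.Fin.Permutation using (Permutation′; _⟨$⟩ʳ_; _⟨$⟩ˡ_; inverseˡ; inverseʳ)
open import Data.List using (List; []; _∷_; [_]; _++_; map; concatMap; filter; length; upTo; allFin)
open import Data.List.Properties using (map-++; map-∘; map-cong; length-map; filter-≐; map-concatMap; concatMap-map)
open import Data.List.Relation.Binary.Permutation.Propositional using (_↭_)
open import Data.List.Relation.Binary.Permutation.Propositional.Properties using (filter-↭; ↭-length)
open import Data.List.Relation.Binary.BagAndSetEquality using (_∼[_]_; bag; [_]-Equality; >>=-cong; ∼bag⇒↭)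
  renaming (map-cong to map-cong-bag)
open import Data.List.Membership.Propositional using (_∈_)
open import Data.List.Membership.Propositional.Properties using (∈-map⁺; ∈-map⁻; ∈-allFin)
open import Data.List.Membership.Propositional.Properties.WithK using (unique∧set⇒bag)
open import Data.List.Relation.Unary.Unique.Propositional using (Unique)
import Data.List.Relation.Unary.Unique.Propositional.Properties as Unique
open import Data.List.Relation.Unary.Unique.DecPropositional using (unique?)
open import Data.Product using (_,_; proj₁; proj₂)
open import Data.Vec using (Vec; tabulate; lookup)
open import Data.Vec.Properties using (lookup∘tabulate; tabulate∘lookup; tabulate-cong) renaming (≡-dec to ≡-decVec)
open import Function.Bundles using (_⇔_; mk⇔; Equivalence)
open import Relation.Nullary using (yes; no; contradiction)
open import Relation.Unary using (Decidable)
open import Relation.Binary.PropositionalEquality using (_≡_; refl; sym; trans; cong; cong₂; subst; module ≡-Reasoning)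
import Relation.Binary.Reasoning.Setoid as SetoidReasoning
open import Relation.Binary.Bundles using (Setoid)

filter-map-comm : ∀ {A B : Set} {P : A → Set} {Q : B → Set}
  (P? : Decidable P) (Q? : Decidable Q) (g : A → B) →
  (∀ x → Q (g x) ⇔ P x) → (xs : List A) →
  filter Q? (map g xs) ≡ map g (filter P? xs)
filter-map-comm P? Q? g Qg⇔P [] = refl
filter-map-comm P? Q? g Qg⇔P (x ∷ xs) with P? x | Q? (g x)
... | yes _   | yes _   = cong (g x ∷_) (filter-map-comm P? Q? g Qg⇔P xs)
... | no _    | no _    = filter-map-comm P? Q? g Qg⇔P xs
... | yes p   | no ¬q   = contradiction (Equivalence.from (Qg⇔P x) p) ¬q
... | no ¬p   | yes q   = contradiction (Equivalence.to (Qg⇔P x) q) ¬p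

map-filter-↭ : ∀ {A : Set} {P Q : A → Set} (P? : Decidable P) (Q? : Decidable Q)
  (g : A → A) → (∀ x → Q (g x) ⇔ P x) → {xs : List A} →
  map g xs ↭ xs → map g (filter P? xs) ↭ filter Q? xs
map-filter-↭ P? Q? g Qg⇔P {xs} gxs↭xs =
  subst (_↭ filter Q? xs) (filter-map-comm P? Q? g Qg⇔P xs) (filter-↭ Q? gxs↭xs)

count-transport : ∀ {A : Set} {P Q : A → Set} (P? : Decidable P) (Q? : Decidable Q)
  (g : A → A) → (∀ x → Q (g x) ⇔ P x) → {xs : List A} →
  map g xs ↭ xs → length (filter P? xs) ≡ length (filter Q? xs)
count-transport P? Q? g Qg⇔P {xs} gxs↭xs = begin
  length (filter P? xs)          ≡⟨ sym (length-map g (filter P? xs)) ⟩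
  length (map g (filter P? xs))  ≡⟨ ↭-length (map-filter-↭ P? Q? g Qg⇔P gxs↭xs) ⟩
  length (filter Q? xs)          ∎
  where open ≡-Reasoning

⟨$⟩ˡ-injective : ∀ {m} (σ : Permutation′ m) {i j : Fin m} → σ ⟨$⟩ˡ i ≡ σ ⟨$⟩ˡ j → i ≡ j
⟨$⟩ˡ-injective σ e = trans (sym (inverseʳ σ)) (trans (cong (σ ⟨$⟩ʳ_) e) (inverseʳ σ))

allFin-permuted : ∀ {m} (σ : Permutation′ m) → map (σ ⟨$⟩ˡ_) (allFin m) ∼[ bag ] allFin m
allFin-permuted {m} σ = unique∧set⇒bag
  (Unique.map⁺ (⟨$⟩ˡ-injective σ) (Unique.allFin⁺ m))
  (Unique.allFin⁺ m)
  (mk⇔ (λ _ → ∈-allFin _) (λ _ → hit _))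
  where
  hit : ∀ i → i ∈ map (σ ⟨$⟩ˡ_) (allFin m)
  hit i = subst (_∈ map (σ ⟨$⟩ˡ_) (allFin m)) (inverseˡ σ) (∈-map⁺ (σ ⟨$⟩ˡ_) (∈-allFin (σ ⟨$⟩ʳ i)))

permute : ∀ {m} → Permutation′ m → Vec ℕ m → Vec ℕ m
permute σ c = tabulate (λ i → lookup c (σ ⟨$⟩ʳ i))

-- permute σ is injective (it is undone by permuting with σ⁻¹); this lets
-- one read off the count vector of t from that of its relabelling.
permute-injective : ∀ {m} (σ : Permutation′ m) {c d : Vec ℕ m} → permute σ c ≡ permute σ d → c ≡ d
permute-injective σ {c} {d} e = begin
  c                          ≡⟨ sym (tabulate∘lookup c) ⟩
  tabulate (lookup c)        ≡⟨ tabulate-cong entry ⟩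
  tabulate (lookup d)        ≡⟨ tabulate∘lookup d ⟩
  d                          ∎
  where
  open ≡-Reasoning
  entry-of : ∀ (v : Vec ℕ _) j → lookup (permute σ v) (σ ⟨$⟩ˡ j) ≡ lookup v j
  entry-of v j = trans (lookup∘tabulate _ (σ ⟨$⟩ˡ j)) (cong (lookup v) (inverseʳ σ))

  entry : ∀ j → lookup c j ≡ lookup d j
  entry j = trans (sym (entry-of c j)) (trans (cong (λ v → lookup v (σ ⟨$⟩ˡ j)) e) (entry-of d j))

module Relabel (k : ℕ) (σ : Permutation′ (suc k)) where

  private module BagEq {A : Set} = Setoid ([ bag ]-Equality A)

  relabelSlot : Slot k → Slot k
  relabelSlot (p , j) = (p , σ ⟨$⟩ˡ j)

  relabel : Code k → Code k
  relabel = map relabelSlot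

  relabelSlot-injective : ∀ {s s′} → relabelSlot s ≡ relabelSlot s′ → s ≡ s′
  relabelSlot-injective {_ , _} {_ , _} e = cong₂ _,_ (cong proj₁ e) (⟨$⟩ˡ-injective σ (cong proj₂ e))

  -- children m t lists the codes of order m+2 extending t, exactly as in the
  -- recursive clause of codes: vertex m+2 becomes the child of p at position j.
  extend : Code k → ℕ → Fin (suc k) → Code k
  extend t p j = t ++ [ (p , j) ]

  children : ℕ → Code k → List (Code k)
  children m t = concatMap (λ p → map (extend t p) (allFin (suc k))) (map suc (upTo (suc m)))

  children-relabel : ∀ m t → map relabel (children m t) ∼[ bag ] children m (relabel t)
  children-relabel m t = begin
    map relabel (children m t)
      ≡⟨ map-concatMap relabel (λ p → map (extend t p) (allFin (suc k))) (map suc (upTo (suc m))) ⟩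
    concatMap (λ p → map relabel (map (extend t p) (allFin (suc k)))) (map suc (upTo (suc m)))
      ≈⟨ >>=-cong {xs = map suc (upTo (suc m))} BagEq.refl at-parent ⟩
    children m (relabel t)
      ∎
    where
    open SetoidReasoning ([ bag ]-Equality (Code k))
    at-parent : ∀ p → map relabel (map (extend t p) (allFin (suc k))) ∼[ bag ] map (extend (relabel t) p) (allFin (suc k))
    at-parent p = begin
      map relabel (map (extend t p) (allFin (suc k)))
        ≡⟨ sym (map-∘ (allFin (suc k))) ⟩
      map (λ j → relabel (extend t p j)) (allFin (suc k))
        ≡⟨ map-cong (λ j → map-++ relabelSlot t [ (p , j) ]) (allFin (suc k)) ⟩
      map (λ j → extend (relabel t) p (σ ⟨$⟩ˡ j)) (allFin (suc k))
        ≡⟨ map-∘ (allFin (suc k)) ⟩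
      map (extend (relabel t) p) (map (σ ⟨$⟩ˡ_) (allFin (suc k)))
        ≈⟨ map-cong-bag (λ _ → refl) (allFin-permuted σ) ⟩
      map (extend (relabel t) p) (allFin (suc k))
        ∎

  codes-relabel : ∀ n → map relabel (codes k n) ∼[ bag ] codes k n
  codes-relabel zero          = BagEq.refl
  codes-relabel (suc zero)    = BagEq.refl
  codes-relabel (suc (suc m)) = begin
    map relabel (codes k (suc (suc m)))
      ≡⟨ map-concatMap relabel (children m) (codes k (suc m)) ⟩
    concatMap (λ t → map relabel (children m t)) (codes k (suc m))
      ≈⟨ >>=-cong {xs = codes k (suc m)} BagEq.refl (children-relabel m) ⟩
    concatMap (λ t → children m (relabel t)) (codes k (suc m))
      ≡⟨ sym (concatMap-map (children m) relabel (codes k (suc m))) ⟩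
    concatMap (children m) (map relabel (codes k (suc m)))
      ≈⟨ >>=-cong (codes-relabel (suc m)) (λ _ → BagEq.refl) ⟩
    codes k (suc (suc m))
      ∎
    where open SetoidReasoning ([ bag ]-Equality (Code k))

  unique-relabel : ∀ t → Unique (relabel t) ⇔ Unique t
  unique-relabel t = mk⇔ Unique.map⁻ (Unique.map⁺ relabelSlot-injective)

  trees-relabel : ∀ n → map relabel (trees k n) ↭ trees k n
  trees-relabel n = map-filter-↭ (unique? _≟S_) (unique? _≟S_) relabel unique-relabel (∼bag⇒↭ (codes-relabel n))

  ∈-relabel : ∀ t v i → (v , i) ∈ relabel t ⇔ (v , σ ⟨$⟩ʳ i) ∈ t
  ∈-relabel t v i = mk⇔ to from
    where
    to : (v , i) ∈ relabel t → (v , σ ⟨$⟩ʳ i) ∈ t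
    to v,i∈ with ∈-map⁻ relabelSlot v,i∈
    ... | (p , j) , p,j∈t , refl = subst (λ j′ → (p , j′) ∈ t) (sym (inverseʳ σ)) p,j∈t

    from : (v , σ ⟨$⟩ʳ i) ∈ t → (v , i) ∈ relabel t
    from ∈t = subst (λ i′ → (v , i′) ∈ relabel t) (inverseˡ σ) (∈-map⁺ relabelSlot ∈t)

  L-relabel : ∀ n t i → L k n (relabel t) i ≡ L k n t (σ ⟨$⟩ʳ i)
  L-relabel n t i = cong length (filter-≐ _ _
    ( (λ {v} empty occupied → empty (Equivalence.from (∈-relabel t v i) occupied))
    , (λ {v} empty occupied → empty (Equivalence.to (∈-relabel t v i) occupied)))
    (map suc (upTo n)))

  Lvec-relabel : ∀ n t → Lvec k n (relabel t) ≡ permute σ (Lvec k n t)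
  Lvec-relabel n t = tabulate-cong (λ i → trans (L-relabel n t i) (sym (lookup∘tabulate (L k n t) (σ ⟨$⟩ʳ i))))

  Lvec-relabel-≡ : ∀ n c t → (Lvec k n (relabel t) ≡ permute σ c) ⇔ (Lvec k n t ≡ c)
  Lvec-relabel-≡ n c t = mk⇔
    (λ e → permute-injective σ (trans (sym (Lvec-relabel n t)) e))
    (λ e → trans (Lvec-relabel n t) (cong (permute σ) e))

-- Theorem 5.1: relabelling positions by σ is a bijection from the trees with
-- count vector c onto the trees with count vector permute σ c.
theorem5p1 : (k n : ℕ) → 1 ≤ k → 1 ≤ n →
    (σ : Permutation′ (suc k)) (c : Vec ℕ (suc k)) →
    count k n c ≡ count k n (tabulate (λ i → lookup c (σ ⟨$⟩ʳ i)))
theorem5p1 k n _ _ σ c =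
  count-transport (λ t → ≡-decVec _≟ℕ_ (Lvec k n t) c)
                  (λ t → ≡-decVec _≟ℕ_ (Lvec k n t) (permute σ c))
                  relabel (Lvec-relabel-≡ n c) (trees-relabel n)
  where open Relabel k σ
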